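{- Let $G=\bigoplus_{n\geq 2}\mathbb{Z}/n\mathbb{Z}$ and let $S=\{g\in G:\ \forall n\geq 2,\ g_n\in\{ -1,0,1\}\}$ (where $g_n\in\mathbb{Z}/n\mathbb{Z}$ denotes the $n$-th coordinate of $g$ and $-1,0,1$ denote the corresponding residues mod $n$). Then the Cayley graph $\mathrm{Cay}(G,S)$ has infinite diameter but does not contain any geodesic ray.
   Context: A graph is a pair $(V,E)$ with $E$ a set of 2-element subsets of $V$ (no loops, no multiple edges), assumed connected and with $V\neq\varnothing$; it need not be locally finite. For a group $G$ and a generating subset $S$ (possibly infinite), the Cayley graph $\mathrm{Cay}(G,S)$ has vertex set $G$, two distinct vertices $g,h$ being adjacent iff $g^{ -1}h\in S\cup S^{ -1}$. The graph distance $d(u,v)$ is the minimal length of a finite path from $u$ to $v$; the diameter is $\sup_{u,v} d(u,v)\in\mathbb{N}\cup\{\infty\}$. A path is a map $\kappa:I\to V$ with $I\subseteq\mathbb{Z}$ a non-empty integer interval and $\{\kappa(n),\kappa(n+1)\}\in E$ whenever $n,n+1\in I$. A path is geodesic if $d(\kappa(m),\kappa(n))=|m-n|$ for all $m,n\in I$. A ray is a path defined on $\mathbb{N}$. -}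

module Defs where

open import Data.Nat using (ℕ; zero; suc; _+_; _∸_; _≤_; _<_; ∣_-_∣)
open import Data.Nat.DivMod using (_%_)
open import Data.Fin using (Fin; toℕ)
open import Data.Product using (Σ; ∃; _×_; _,_)
open import Data.Sum using (_⊎_)
open import Relation.Nullary using (¬_)
open import Relation.Binary.PropositionalEquality using (_≡_)

-- Coordinate index i : ℕ stands for the summand ℤ/(i+2)ℤ, i.e. n = i + 2 ≥ 2.
Mod : ℕ → ℕ
Mod i = suc (suc i)

record G : Set where
  field
    coord   : (i : ℕ) → Fin (Mod i)
    finSupp : ∃ λ N → ∀ i → N ≤ i → toℕ (coord i) ≡ 0
open G public

_≈G_ : G → G → Set
g ≈G h = ∀ i → coord g i ≡ coord h i

-- i-th coordinate (as residue in {0,…,i+1}) of g⁻¹h = h − g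
diffC : (i : ℕ) → G → G → ℕ
diffC i g h = (Mod i + toℕ (coord h i) ∸ toℕ (coord g i)) % Mod i

-- a residue r mod m (0 ≤ r < m) is one of -1, 0, 1
IsUnitStep : (m r : ℕ) → Set
IsUnitStep m r = r ≡ 0 ⊎ r ≡ 1 ⊎ suc r ≡ m

InvMulInS : G → G → Set
InvMulInS g h = ∀ i → IsUnitStep (Mod i) (diffC i g h)

-- adjacency in Cay(G,S): distinct and g⁻¹h ∈ S ∪ S⁻¹
-- (g⁻¹h ∈ S⁻¹ iff h⁻¹g ∈ S)
Adj : G → G → Set
Adj g h = ¬ (g ≈G h) × (InvMulInS g h ⊎ InvMulInS h g)

PathOfLen : G → G → ℕ → Set
PathOfLen u v zero    = u ≈G v
PathOfLen u v (suc k) = Σ G λ w → Adj u w × PathOfLen w v k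

DistIs : G → G → ℕ → Set
DistIs u v k = PathOfLen u v k × (∀ j → j < k → ¬ PathOfLen u v j)

InfiniteDiameter : Set
InfiniteDiameter = ∀ k → Σ G λ u → Σ G λ v → ∀ j → j ≤ k → ¬ PathOfLen u v j

IsGeodesicRay : (ℕ → G) → Set
IsGeodesicRay κ = (∀ n → Adj (κ n) (κ (suc n))) × (∀ m n → DistIs (κ m) (κ n) ∣ m - n ∣)

-- A step in Cay(G,S) moves every coordinate by −1, 0 or +1 in its cycle ℤ/nℤ. Hence a
-- path of length j from 0 only reaches elements all of whose coordinates lie within j
-- steps of 0 on their cycles, and the element with value k+1 in ℤ/(2k+2)ℤ is at
-- distance more than k from 0: the diameter is infinite.
--
-- Suppose κ is a geodesic ray and let N bound the supports of κ(0) and κ(1), so these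
-- agree from coordinate N on. Walk from κ(0) to κ(N+2) in N+1 steps: coordinate i < N
-- advances by +1 per step until it reaches its value in κ(N+2), which takes fewer than
-- i+2 ≤ N+1 steps, while every coordinate i ≥ N copies κ(1), κ(2), …, κ(N+2). Every step
-- is trivial or an edge, so d(κ(0), κ(N+2)) ≤ N+1, contradicting geodesicity. Whether a
-- step is trivial is only decided under a double negation, which suffices because the
-- goal is a negation.
module Submission where

open import Defs
open import Data.Nat using (ℕ; zero; suc; _+_; _∸_; _≤_; _<_; _⊓_; _⊔_; z≤n; s≤s; NonZero; _<?_; _≤?_; _≟_)
open import Data.Nat.Properties
open import Data.Nat.DivMod using (_%_; m%n<n; m%n%n≡m%n; %-distribˡ-+; [m+n]%n≡m%n; m<n⇒m%n≡m; m≤n⇒[n∸m]%m≡n%m; n%n≡0)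
open import Data.Fin using (Fin; toℕ; fromℕ<) renaming (zero to fzero)
open import Data.Fin.Properties using (toℕ-fromℕ<; toℕ-injective; toℕ<n)
open import Data.Bool using (if_then_else_)
open import Data.Product using (∃; _×_; _,_; proj₁; proj₂)
open import Data.Sum using (_⊎_; inj₁; inj₂)
open import Data.Empty using (⊥-elim)
open import Effect.Monad using (RawMonad)
open import Relation.Nullary using (¬_; Dec; yes; no; does)
open import Relation.Nullary.Decidable using (dec-true; dec-false)
open import Relation.Nullary.Negation using (DoubleNegation; ¬¬-map; ¬¬-Monad)
open import Relation.Nullary.Decidable.Core using (¬¬-excluded-middle)
open import Relation.Binary.PropositionalEquality
open ≡-Reasoning

[m%d+n]%d≡[m+n]%d : ∀ m n d .{{_ : NonZero d}} → (m % d + n) % d ≡ (m + n) % d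
[m%d+n]%d≡[m+n]%d m n d = begin
  (m % d + n) % d          ≡⟨ %-distribˡ-+ (m % d) n d ⟩
  (m % d % d + n % d) % d  ≡⟨ cong (λ v → (v + n % d) % d) (m%n%n≡m%n m d) ⟩
  (m % d + n % d) % d      ≡⟨ %-distribˡ-+ m n d ⟨
  (m + n) % d              ∎

[m+n%d]%d≡[m+n]%d : ∀ m n d .{{_ : NonZero d}} → (m + n % d) % d ≡ (m + n) % d
[m+n%d]%d≡[m+n]%d m n d = begin
  (m + n % d) % d  ≡⟨ cong (_% d) (+-comm m (n % d)) ⟩
  (n % d + m) % d  ≡⟨ [m%d+n]%d≡[m+n]%d n m d ⟩
  (n + m) % d      ≡⟨ cong (_% d) (+-comm n m) ⟩
  (m + n) % d      ∎

[m+n]%n≡m : ∀ {m n} .{{_ : NonZero n}} → m < n → (m + n) % n ≡ m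
[m+n]%n≡m {m} {n} m<n = trans ([m+n]%n≡m%n m n) (m<n⇒m%n≡m m<n)

diffMod : ℕ → ℕ → ℕ → ℕ
diffMod k x y = (Mod k + y ∸ x) % Mod k

diffMod<Mod : ∀ k x y → diffMod k x y < Mod k
diffMod<Mod k x y = m%n<n (Mod k + y ∸ x) (Mod k)

+-diffMod : ∀ {k x y} → x < Mod k → y < Mod k → (x + diffMod k x y) % Mod k ≡ y
+-diffMod {k} {x} {y} x<m y<m = begin
  (x + (Mod k + y ∸ x) % Mod k) % Mod k  ≡⟨ [m+n%d]%d≡[m+n]%d x (Mod k + y ∸ x) (Mod k) ⟩
  (x + (Mod k + y ∸ x)) % Mod k          ≡⟨ cong (_% Mod k) (m+[n∸m]≡n (≤-trans (<⇒≤ x<m) (m≤m+n (Mod k) y))) ⟩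
  (Mod k + y) % Mod k                    ≡⟨ cong (_% Mod k) (+-comm (Mod k) y) ⟩
  (y + Mod k) % Mod k                    ≡⟨ [m+n]%n≡m y<m ⟩
  y                                      ∎

diffMod-+ : ∀ {k x d} → x < Mod k → d < Mod k → diffMod k x ((x + d) % Mod k) ≡ d
diffMod-+ {k} {x} {d} x<m d<m with x + d <? Mod k
... | yes x+d<m = begin
  (Mod k + (x + d) % Mod k ∸ x) % Mod k  ≡⟨ cong (λ r → (Mod k + r ∸ x) % Mod k) (m<n⇒m%n≡m x+d<m) ⟩
  (Mod k + (x + d) ∸ x) % Mod k          ≡⟨ cong (λ n → (n ∸ x) % Mod k) rearrange ⟩
  (x + (d + Mod k) ∸ x) % Mod k          ≡⟨ cong (_% Mod k) (m+n∸m≡n x (d + Mod k)) ⟩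
  (d + Mod k) % Mod k                    ≡⟨ [m+n]%n≡m d<m ⟩
  d                                      ∎
  where
  rearrange : Mod k + (x + d) ≡ x + (d + Mod k)
  rearrange = trans (+-comm (Mod k) (x + d)) (+-assoc x d (Mod k))
... | no x+d≮m = begin
  (Mod k + (x + d) % Mod k ∸ x) % Mod k  ≡⟨ cong (λ r → (Mod k + r ∸ x) % Mod k) wrapped ⟩
  (Mod k + (x + d ∸ Mod k) ∸ x) % Mod k  ≡⟨ cong (λ n → (n ∸ x) % Mod k) (m+[n∸m]≡n m≤x+d) ⟩
  (x + d ∸ x) % Mod k                    ≡⟨ cong (_% Mod k) (m+n∸m≡n x d) ⟩
  d % Mod k                              ≡⟨ m<n⇒m%n≡m d<m ⟩
  d                                      ∎
  where
  m≤x+d : Mod k ≤ x + d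
  m≤x+d = ≮⇒≥ x+d≮m
  wrapped : (x + d) % Mod k ≡ x + d ∸ Mod k
  wrapped = trans (sym (m≤n⇒[n∸m]%m≡n%m m≤x+d))
                  (m<n⇒m%n≡m (m<n+o⇒m∸n<o (x + d) (Mod k) (+-mono-< x<m d<m)))

CyclicallyAdjacent : ℕ → ℕ → ℕ → Set
CyclicallyAdjacent k x y = y ≡ x ⊎ y ≡ suc x % Mod k ⊎ x ≡ suc y % Mod k

cyclicallyAdjacent-sym : ∀ {k x y} → CyclicallyAdjacent k x y → CyclicallyAdjacent k y x
cyclicallyAdjacent-sym (inj₁ y≡x)        = inj₁ (sym y≡x)
cyclicallyAdjacent-sym (inj₂ (inj₁ fwd)) = inj₂ (inj₂ fwd)
cyclicallyAdjacent-sym (inj₂ (inj₂ bwd)) = inj₂ (inj₁ bwd)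

unitStep⇒cyclicallyAdjacent : ∀ {k x y} → x < Mod k → y < Mod k →
  IsUnitStep (Mod k) (diffMod k x y) → CyclicallyAdjacent k x y
unitStep⇒cyclicallyAdjacent {k} {x} {y} x<m y<m unit with diffMod k x y | +-diffMod x<m y<m
unitStep⇒cyclicallyAdjacent {k} {x} x<m _ (inj₁ refl) | _ | x+0≡y =
  inj₁ (trans (sym x+0≡y) (trans (cong (_% Mod k) (+-identityʳ x)) (m<n⇒m%n≡m x<m)))
unitStep⇒cyclicallyAdjacent {k} {x} _ _ (inj₂ (inj₁ refl)) | _ | x+1≡y =
  inj₂ (inj₁ (trans (sym x+1≡y) (cong (_% Mod k) (+-comm x 1))))
unitStep⇒cyclicallyAdjacent {k} {x} {y} x<m _ (inj₂ (inj₂ refl)) | _ | x-1≡y =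
  inj₂ (inj₂ (sym (begin
    suc y % Mod k                    ≡⟨ cong (λ v → suc v % Mod k) (sym x-1≡y) ⟩
    suc ((x + suc k) % Mod k) % Mod k ≡⟨ [m+n%d]%d≡[m+n]%d 1 (x + suc k) (Mod k) ⟩
    suc (x + suc k) % Mod k          ≡⟨ cong (_% Mod k) (+-suc x (suc k)) ⟨
    (x + Mod k) % Mod k              ≡⟨ [m+n]%n≡m x<m ⟩
    x                                ∎)))

cyclicallyAdjacent⇒unitStep : ∀ {k x y} → x < Mod k → y < Mod k →
  CyclicallyAdjacent k x y → IsUnitStep (Mod k) (diffMod k x y)
cyclicallyAdjacent⇒unitStep {k} {x} _ _ (inj₁ refl) =
  inj₁ (trans (cong (_% Mod k) (m+n∸n≡m (Mod k) x)) (n%n≡0 (Mod k)))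
cyclicallyAdjacent⇒unitStep {k} {x} x<m _ (inj₂ (inj₁ refl)) =
  inj₂ (inj₁ (trans (cong (λ n → diffMod k x (n % Mod k)) (+-comm 1 x)) (diffMod-+ x<m (s≤s (s≤s z≤n)))))
cyclicallyAdjacent⇒unitStep {k} {_} {y} _ y<m (inj₂ (inj₂ refl)) =
  inj₂ (inj₂ (cong suc (trans (cong (diffMod k (suc y % Mod k)) y≡y+1-1)
                              (diffMod-+ (m%n<n (suc y) (Mod k)) ≤-refl))))
  where
  y≡y+1-1 : y ≡ (suc y % Mod k + suc k) % Mod k
  y≡y+1-1 = sym (begin
    (suc y % Mod k + suc k) % Mod k  ≡⟨ [m%d+n]%d≡[m+n]%d (suc y) (suc k) (Mod k) ⟩
    suc (y + suc k) % Mod k          ≡⟨ cong (_% Mod k) (+-suc y (suc k)) ⟨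
    (y + Mod k) % Mod k              ≡⟨ [m+n]%n≡m y<m ⟩
    y                                ∎)

-- Within j steps of 0 on the cycle ℤ/(Mod k)ℤ, i.e. min(x, Mod k − x) ≤ j.
CycleNorm≤ : ℕ → ℕ → ℕ → Set
CycleNorm≤ k x j = x ≤ j ⊎ Mod k ≤ x + j

cycleNorm≤-suc : ∀ {k x j} → CycleNorm≤ k x j → CycleNorm≤ k x (suc j)
cycleNorm≤-suc (inj₁ x≤j)   = inj₁ (m≤n⇒m≤1+n x≤j)
cycleNorm≤-suc {x = x} (inj₂ m≤x+j) = inj₂ (≤-trans m≤x+j (+-monoʳ-≤ x (n≤1+n _)))

cycleNorm≤-pred : ∀ {k x j} → CycleNorm≤ k (suc x) j → CycleNorm≤ k x (suc j)
cycleNorm≤-pred (inj₁ sx≤j)     = inj₁ (m≤n⇒m≤1+n (<⇒≤ sx≤j))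
cycleNorm≤-pred {x = x} {j} (inj₂ m≤sx+j) = inj₂ (≤-trans m≤sx+j (≤-reflexive (sym (+-suc x j))))

cycleNorm≤-step : ∀ {k x y j} → x < Mod k → y < Mod k →
  CyclicallyAdjacent k x y → CycleNorm≤ k y j → CycleNorm≤ k x (suc j)
cycleNorm≤-step _ _ (inj₁ refl) ‖y‖≤j = cycleNorm≤-suc ‖y‖≤j
cycleNorm≤-step {k} {x} {j = j} x<m _ (inj₂ (inj₁ refl)) ‖y‖≤j with m≤n⇒m<n∨m≡n x<m
... | inj₁ sx<m = cycleNorm≤-pred (subst (λ y → CycleNorm≤ k y j) (m<n⇒m%n≡m sx<m) ‖y‖≤j)
... | inj₂ sx≡m =
  inj₂ (subst (_≤ x + suc j) sx≡m (≤-trans (s≤s (m≤m+n x j)) (≤-reflexive (sym (+-suc x j)))))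
cycleNorm≤-step {k} {j = j} _ y<m (inj₂ (inj₂ refl)) ‖y‖≤j with m≤n⇒m<n∨m≡n y<m
... | inj₁ sy<m = subst (λ x → CycleNorm≤ k x (suc j)) (sym (m<n⇒m%n≡m sy<m)) (succ ‖y‖≤j)
  where
  succ : ∀ {y} → CycleNorm≤ k y j → CycleNorm≤ k (suc y) (suc j)
  succ (inj₁ y≤j)   = inj₁ (s≤s y≤j)
  succ {y} (inj₂ m≤y+j) = inj₂ (≤-trans m≤y+j (m≤n⇒m≤1+n (+-monoʳ-≤ y (n≤1+n j))))
... | inj₂ sy≡m = inj₁ (≤-trans (≤-reflexive (trans (cong (_% Mod k) sy≡m) (n%n≡0 (Mod k)))) z≤n)

antipode-far : ∀ {k j} → j ≤ k → ¬ CycleNorm≤ (k + k) (suc k) j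
antipode-far j≤k (inj₁ sk≤j)  = 1+n≰n (≤-trans sk≤j j≤k)
antipode-far {k} j≤k (inj₂ m≤sk+j) = 1+n≰n (≤-trans m≤sk+j (s≤s (+-monoʳ-≤ k j≤k)))

coordℕ : G → ℕ → ℕ
coordℕ g i = toℕ (coord g i)

CoordinatewiseAdjacent : G → G → Set
CoordinatewiseAdjacent g h = ∀ i → CyclicallyAdjacent i (coordℕ g i) (coordℕ h i)

invMulInS⇒coordinatewiseAdjacent : ∀ {g h} → InvMulInS g h → CoordinatewiseAdjacent g h
invMulInS⇒coordinatewiseAdjacent {g} {h} s i =
  unitStep⇒cyclicallyAdjacent {i} {coordℕ g i} {coordℕ h i} (toℕ<n (coord g i)) (toℕ<n (coord h i)) (s i)

coordinatewiseAdjacent⇒invMulInS : ∀ {g h} → CoordinatewiseAdjacent g h → InvMulInS g h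
coordinatewiseAdjacent⇒invMulInS {g} {h} a i =
  cyclicallyAdjacent⇒unitStep {i} {coordℕ g i} {coordℕ h i} (toℕ<n (coord g i)) (toℕ<n (coord h i)) (a i)

adj⇒coordinatewiseAdjacent : ∀ {g h} → Adj g h → CoordinatewiseAdjacent g h
adj⇒coordinatewiseAdjacent {g} {h} (_ , inj₁ s) = invMulInS⇒coordinatewiseAdjacent {g} {h} s
adj⇒coordinatewiseAdjacent {g} {h} (_ , inj₂ s) i =
  cyclicallyAdjacent-sym (invMulInS⇒coordinatewiseAdjacent {h} {g} s i)

coordinatewiseAdjacent-respˡ : ∀ {g g′ h} → g ≈G g′ → CoordinatewiseAdjacent g h → CoordinatewiseAdjacent g′ h
coordinatewiseAdjacent-respˡ {h = h} g≈g′ a i =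
  subst (λ c → CyclicallyAdjacent i (toℕ c) (coordℕ h i)) (g≈g′ i) (a i)

Adj-respˡ : ∀ {g g′ h} → g ≈G g′ → Adj g h → Adj g′ h
Adj-respˡ {g} {g′} {h} g≈g′ a@(g≉h , _) =
  (λ g′≈h → g≉h (λ i → trans (g≈g′ i) (g′≈h i))) ,
  inj₁ (coordinatewiseAdjacent⇒invMulInS {g′} {h}
          (coordinatewiseAdjacent-respˡ {g} {g′} {h} g≈g′ (adj⇒coordinatewiseAdjacent {g} {h} a)))

PathOfLen-respˡ : ∀ {u u′ v} j → u ≈G u′ → PathOfLen u v j → PathOfLen u′ v j
PathOfLen-respˡ zero    u≈u′ u≈v           = λ i → trans (sym (u≈u′ i)) (u≈v i)
PathOfLen-respˡ {u} {u′} (suc j) u≈u′ (w , a , path) = w , Adj-respˡ {u} {u′} {w} u≈u′ a , path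

PathOfLen-respʳ : ∀ {u v v′} j → v ≈G v′ → PathOfLen u v j → PathOfLen u v′ j
PathOfLen-respʳ zero    v≈v′ u≈v           = λ i → trans (u≈v i) (v≈v′ i)
PathOfLen-respʳ (suc j) v≈v′ (w , a , path) = w , a , PathOfLen-respʳ j v≈v′ path

ε : G
ε = record { coord = λ _ → fzero ; finSupp = 0 , λ _ _ → refl }

pathOfLen-to-ε⇒cycleNorm≤ : ∀ {u} j → PathOfLen u ε j → ∀ i → CycleNorm≤ i (coordℕ u i) j
pathOfLen-to-ε⇒cycleNorm≤ zero    u≈ε            i = inj₁ (≤-reflexive (cong toℕ (u≈ε i)))
pathOfLen-to-ε⇒cycleNorm≤ {u} (suc j) (w , a , path) i =
  cycleNorm≤-step (toℕ<n (coord u i)) (toℕ<n (coord w i)) (adj⇒coordinatewiseAdjacent {u} {w} a i)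
    (pathOfLen-to-ε⇒cycleNorm≤ j path i)

single : (i : ℕ) → Fin (Mod i) → G
coord (single i r) j with j ≟ i
... | yes refl = r
... | no _     = fzero
finSupp (single i r) = suc i , vanish
  where
  vanish : ∀ j → suc i ≤ j → toℕ (coord (single i r) j) ≡ 0
  vanish j i<j with j ≟ i
  ... | yes refl = ⊥-elim (1+n≰n i<j)
  ... | no _     = refl

coordℕ-single : ∀ i r → coordℕ (single i r) i ≡ toℕ r
coordℕ-single i r with i ≟ i
... | yes refl = refl
... | no i≢i   = ⊥-elim (i≢i refl)

infiniteDiameter : InfiniteDiameter
infiniteDiameter k = single (k + k) (fromℕ< k+1<m) , ε , λ j j≤k path →
  antipode-far j≤k (subst (λ x → CycleNorm≤ (k + k) x j) coord≡k+1 (pathOfLen-to-ε⇒cycleNorm≤ j path (k + k)))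
  where
  k+1<m : suc k < Mod (k + k)
  k+1<m = s≤s (s≤s (m≤m+n k k))
  coord≡k+1 : coordℕ (single (k + k) (fromℕ< k+1<m)) (k + k) ≡ suc k
  coord≡k+1 = trans (coordℕ-single (k + k) _) (toℕ-fromℕ< k+1<m)

walk⇒path : (p : ℕ → G) → (∀ t → CoordinatewiseAdjacent (p t) (p (suc t))) →
  ∀ k → DoubleNegation (∃ λ j → j ≤ k × PathOfLen (p 0) (p k) j)
walk⇒path p steps zero    = λ noPath → noPath (0 , z≤n , λ _ → refl)
walk⇒path p steps (suc k) = do
  (j , j≤k , path) ← walk⇒path (λ t → p (suc t)) (λ t → steps (suc t)) k
  p₀≈p₁? ← ¬¬-excluded-middle
  return (prepend j≤k path p₀≈p₁?)
  where
  open RawMonad ¬¬-Monad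
  prepend : ∀ {j} → j ≤ k → PathOfLen (p 1) (p (suc k)) j → Dec (p 0 ≈G p 1) →
    ∃ λ j′ → j′ ≤ suc k × PathOfLen (p 0) (p (suc k)) j′
  prepend {j} j≤k path (yes p₀≈p₁) = j , m≤n⇒m≤1+n j≤k , PathOfLen-respˡ j (λ i → sym (p₀≈p₁ i)) path
  prepend {j} j≤k path (no p₀≉p₁)  =
    suc j , s≤s j≤k , p 1 , (p₀≉p₁ , inj₁ (coordinatewiseAdjacent⇒invMulInS {p 0} {p 1} (steps 0))) , path

interpolate : ℕ → ℕ → ℕ → ℕ → ℕ
interpolate k x y t = (x + t ⊓ diffMod k x y) % Mod k

interpolate-zero : ∀ {k x} y → x < Mod k → interpolate k x y 0 ≡ x
interpolate-zero {k} {x} _ x<m = trans (cong (_% Mod k) (+-identityʳ x)) (m<n⇒m%n≡m x<m)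

interpolate-end : ∀ {k x y t} → x < Mod k → y < Mod k → diffMod k x y ≤ t → interpolate k x y t ≡ y
interpolate-end {k} {x} x<m y<m d≤t = trans (cong (λ s → (x + s) % Mod k) (m≥n⇒m⊓n≡n d≤t)) (+-diffMod x<m y<m)

interpolate-step : ∀ k x y t → CyclicallyAdjacent k (interpolate k x y t) (interpolate k x y (suc t))
interpolate-step k x y t with diffMod k x y ≤? t
... | yes d≤t = inj₁ (begin
  (x + suc t ⊓ diffMod k x y) % Mod k  ≡⟨ cong (λ s → (x + s) % Mod k) (m≥n⇒m⊓n≡n (m≤n⇒m≤1+n d≤t)) ⟩
  (x + diffMod k x y) % Mod k          ≡⟨ cong (λ s → (x + s) % Mod k) (m≥n⇒m⊓n≡n d≤t) ⟨
  (x + t ⊓ diffMod k x y) % Mod k      ∎)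
... | no d≰t = inj₂ (inj₁ (begin
  (x + suc t ⊓ diffMod k x y) % Mod k          ≡⟨ cong (λ s → (x + s) % Mod k) (m≤n⇒m⊓n≡m t<d) ⟩
  (x + suc t) % Mod k                          ≡⟨ cong (_% Mod k) (+-suc x t) ⟩
  suc (x + t) % Mod k                          ≡⟨ [m+n%d]%d≡[m+n]%d 1 (x + t) (Mod k) ⟨
  suc ((x + t) % Mod k) % Mod k                ≡⟨ cong (λ s → suc ((x + s) % Mod k) % Mod k) (m≤n⇒m⊓n≡m (<⇒≤ t<d)) ⟨
  suc ((x + t ⊓ diffMod k x y) % Mod k) % Mod k ∎))
  where
  t<d : t < diffMod k x y
  t<d = ≰⇒> d≰t

interpolateFin : (k x y t : ℕ) → Fin (Mod k)
interpolateFin k x y t = fromℕ< (m%n<n (x + t ⊓ diffMod k x y) (Mod k))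

patchBelow : ℕ → ((i : ℕ) → Fin (Mod i)) → G → G
coord (patchBelow N f g) i = if does (i <? N) then f i else coord g i
finSupp (patchBelow N f g) = N ⊔ proj₁ (finSupp g) , vanish
  where
  vanish : ∀ i → N ⊔ proj₁ (finSupp g) ≤ i → toℕ (coord (patchBelow N f g) i) ≡ 0
  vanish i bound rewrite dec-false (i <? N) (≤⇒≯ (≤-trans (m≤m⊔n N _) bound)) =
    proj₂ (finSupp g) i (≤-trans (m≤n⊔m N _) bound)

coord-patchBelow-< : ∀ {N f g i} → i < N → coord (patchBelow N f g) i ≡ f i
coord-patchBelow-< {N} {i = i} i<N rewrite dec-true (i <? N) i<N = refl

coord-patchBelow-≥ : ∀ {N f g i} → N ≤ i → coord (patchBelow N f g) i ≡ coord g i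
coord-patchBelow-≥ {N} {i = i} N≤i rewrite dec-false (i <? N) (≤⇒≯ N≤i) = refl

module ShortcutOfRay (κ : ℕ → G) (κ-adj : ∀ n → Adj (κ n) (κ (suc n))) where

  N : ℕ
  N = proj₁ (finSupp (κ 0)) ⊔ proj₁ (finSupp (κ 1))

  target : G
  target = κ (suc (suc N))

  approach : ℕ → (i : ℕ) → Fin (Mod i)
  approach t i = interpolateFin i (coordℕ (κ 0) i) (coordℕ target i) t

  shortcut : ℕ → G
  shortcut t = patchBelow N (approach t) (κ (suc t))

  coordℕ-shortcut-< : ∀ {t i} → i < N →
    coordℕ (shortcut t) i ≡ interpolate i (coordℕ (κ 0) i) (coordℕ target i) t
  coordℕ-shortcut-< {t} i<N =
    trans (cong toℕ (coord-patchBelow-< {N} {approach t} {κ (suc t)} i<N)) (toℕ-fromℕ< _)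

  coordℕ-shortcut-≥ : ∀ {t i} → N ≤ i → coordℕ (shortcut t) i ≡ coordℕ (κ (suc t)) i
  coordℕ-shortcut-≥ {t} N≤i = cong toℕ (coord-patchBelow-≥ {N} {approach t} {κ (suc t)} N≤i)

  shortcut-step : ∀ t → CoordinatewiseAdjacent (shortcut t) (shortcut (suc t))
  shortcut-step t i with i <? N
  ... | yes i<N = subst₂ (CyclicallyAdjacent i) (sym (coordℕ-shortcut-< i<N)) (sym (coordℕ-shortcut-< i<N))
                    (interpolate-step i (coordℕ (κ 0) i) (coordℕ target i) t)
  ... | no i≮N  = subst₂ (CyclicallyAdjacent i) (sym (coordℕ-shortcut-≥ N≤i)) (sym (coordℕ-shortcut-≥ N≤i))
                    (adj⇒coordinatewiseAdjacent {κ (suc t)} {κ (suc (suc t))} (κ-adj (suc t)) i)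
    where
    N≤i : N ≤ i
    N≤i = ≮⇒≥ i≮N

  shortcut-start : shortcut 0 ≈G κ 0
  shortcut-start i = toℕ-injective (start (i <? N))
    where
    start : Dec (i < N) → coordℕ (shortcut 0) i ≡ coordℕ (κ 0) i
    start (yes i<N) =
      trans (coordℕ-shortcut-< i<N) (interpolate-zero (coordℕ target i) (toℕ<n (coord (κ 0) i)))
    start (no i≮N)  = begin
      coordℕ (shortcut 0) i  ≡⟨ coordℕ-shortcut-≥ N≤i ⟩
      coordℕ (κ 1) i         ≡⟨ proj₂ (finSupp (κ 1)) i (≤-trans (m≤n⊔m _ _) N≤i) ⟩
      0                      ≡⟨ proj₂ (finSupp (κ 0)) i (≤-trans (m≤m⊔n _ _) N≤i) ⟨
      coordℕ (κ 0) i         ∎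
      where
      N≤i : N ≤ i
      N≤i = ≮⇒≥ i≮N

  -- Coordinate i < N needs diffMod < Mod i ≤ N + 1 forward steps.
  shortcut-end : shortcut (suc N) ≈G target
  shortcut-end i = toℕ-injective (end (i <? N))
    where
    end : Dec (i < N) → coordℕ (shortcut (suc N)) i ≡ coordℕ target i
    end (yes i<N) = trans (coordℕ-shortcut-< i<N)
      (interpolate-end {i} {coordℕ (κ 0) i} {coordℕ target i} {suc N}
        (toℕ<n (coord (κ 0) i)) (toℕ<n (coord target i))
        (<⇒≤ (<-≤-trans (diffMod<Mod i (coordℕ (κ 0) i) (coordℕ target i)) (s≤s i<N))))
    end (no i≮N)  = coordℕ-shortcut-≥ (≮⇒≥ i≮N)

  shortcut-path : DoubleNegation (∃ λ j → j ≤ suc N × PathOfLen (κ 0) target j)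
  shortcut-path =
    ¬¬-map (λ { (j , j≤ , path) → j , j≤ , fixEndpoints j path }) (walk⇒path shortcut shortcut-step (suc N))
    where
    fixEndpoints : ∀ j → PathOfLen (shortcut 0) (shortcut (suc N)) j → PathOfLen (κ 0) target j
    fixEndpoints j path = PathOfLen-respʳ j shortcut-end (PathOfLen-respˡ j shortcut-start path)

noGeodesicRay : ¬ (∃ λ (κ : ℕ → G) → IsGeodesicRay κ)
noGeodesicRay (κ , κ-adj , κ-dist) =
  shortcut-path λ { (j , j≤N+1 , path) → proj₂ (κ-dist 0 (suc (suc N))) j (s≤s j≤N+1) path }
  where open ShortcutOfRay κ κ-adj

mainTheorem1 : InfiniteDiameter × ¬ (∃ λ (κ : ℕ → G) → IsGeodesicRay κ)
mainTheorem1 = infiniteDiameter , noGeodesicRay
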